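{- Let $k\ge3$. Every $D_k$-graph and every $E_k$-graph $G$ satisfies $|E(G)|\le |V(G)|(k-2)$.
   Context: For $k\ge3$, a $D_k$-graph is a graph whose vertex set consists of three nonempty pairwise disjoint sets $X,Y_1,Y_2$ with $|Y_1|+|Y_2|=|X|+1=k-1$, together with two further vertices $x_1,x_2$, such that $X$ and $Y_1\cup Y_2$ are cliques with no edges between them, $x_i$ is adjacent to every vertex of $X\cup Y_i$ for $i=1,2$, and there are no other edges. For $k\ge3$, an $E_k$-graph is a graph whose vertex set consists of four nonempty pairwise disjoint sets $X_1,X_2,Y_1,Y_2$ with $|Y_1|+|Y_2|=|X_1|+|X_2|=k-1$ and $|X_2|+|Y_2|\le k-1$, together with one further vertex $z$, such that $X=X_1\cup X_2$ and $Y=Y_1\cup Y_2$ are cliques, $z$ is adjacent to every vertex of $X_1\cup Y_1$, $x\in X$ is adjacent to $y\in Y$ iff $x\in X_2$ and $y\in Y_2$, and there are no other edges. (Such graphs are strong $k$-chromatic-choosable, and the inequality in the claim is what the paper calls the edge condition.) -}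

module Defs where

open import Data.Nat using (ℕ; zero; suc; _+_; _*_; _∸_; _≤_; _<ᵇ_)
open import Data.Fin using (Fin; toℕ)
open import Data.Bool using (Bool; true; false; _∧_; T)
open import Data.List using (List; length; filter; allFin; concatMap; map)
open import Data.Product using (Σ; _×_; _,_)
open import Relation.Binary.PropositionalEquality using (_≡_)
open import Relation.Nullary.Decidable using (does)
open import Data.Bool.Properties using (T?)

record Graph : Set where
  field
    n      : ℕ
    adj    : Fin n → Fin n → Bool
    sym    : ∀ u v → adj u v ≡ adj v u
    irrefl : ∀ v → adj v v ≡ false
open Graph public

∣V∣ : Graph → ℕ
∣V∣ G = n G

∣E∣ : Graph → ℕ
∣E∣ G = length (filter (λ p → T? (isEdge p))
                 (concatMap (λ u → map (λ v → u , v) (allFin (n G))) (allFin (n G))))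
  where
  isEdge : Fin (n G) × Fin (n G) → Bool
  isEdge (u , v) = (toℕ u <ᵇ toℕ v) ∧ adj G u v

countV : (G : Graph) → (Fin (n G) → Bool) → ℕ
countV G P = length (filter (λ v → T? (P v)) (allFin (n G)))

-- D_k-graphs: labels for the parts X, Y₁, Y₂ and the vertices x₁, x₂.

data DLab : Set where
  dX dY₁ dY₂ dx₁ dx₂ : DLab

_=ᴰ_ : DLab → DLab → Bool
dX  =ᴰ dX  = true
dY₁ =ᴰ dY₁ = true
dY₂ =ᴰ dY₂ = true
dx₁ =ᴰ dx₁ = true
dx₂ =ᴰ dx₂ = true
_   =ᴰ _   = false

DAdj : DLab → DLab → Bool
DAdj dX  dX  = true
DAdj dY₁ dY₁ = true
DAdj dY₁ dY₂ = true
DAdj dY₂ dY₁ = true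
DAdj dY₂ dY₂ = true
DAdj dx₁ dX  = true
DAdj dX  dx₁ = true
DAdj dx₁ dY₁ = true
DAdj dY₁ dx₁ = true
DAdj dx₂ dX  = true
DAdj dX  dx₂ = true
DAdj dx₂ dY₂ = true
DAdj dY₂ dx₂ = true
DAdj _   _   = false

IsD : ℕ → Graph → Set
IsD k G = Σ (Fin (n G) → DLab) λ lab →
    let c : DLab → ℕ
        c L = countV G (λ v → lab v =ᴰ L)
    in (c dx₁ ≡ 1) × (c dx₂ ≡ 1)
     × (1 ≤ c dX) × (1 ≤ c dY₁) × (1 ≤ c dY₂)
     × (c dY₁ + c dY₂ ≡ k ∸ 1) × (c dX + 1 ≡ k ∸ 1)
     × (∀ u v → ¬≡ u v → adj G u v ≡ DAdj (lab u) (lab v))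
  where
  open import Relation.Nullary using (¬_)
  ¬≡ : Fin (n G) → Fin (n G) → Set
  ¬≡ u v = ¬ (u ≡ v)

-- E_k-graphs: labels for the parts X₁, X₂, Y₁, Y₂ and the vertex z.

data ELab : Set where
  eX₁ eX₂ eY₁ eY₂ ez : ELab

_=ᴱ_ : ELab → ELab → Bool
eX₁ =ᴱ eX₁ = true
eX₂ =ᴱ eX₂ = true
eY₁ =ᴱ eY₁ = true
eY₂ =ᴱ eY₂ = true
ez  =ᴱ ez  = true
_   =ᴱ _   = false

EAdj : ELab → ELab → Bool
EAdj eX₁ eX₁ = true
EAdj eX₁ eX₂ = true
EAdj eX₂ eX₁ = true
EAdj eX₂ eX₂ = true
EAdj eY₁ eY₁ = true
EAdj eY₁ eY₂ = true
EAdj eY₂ eY₁ = true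
EAdj eY₂ eY₂ = true
EAdj eX₂ eY₂ = true
EAdj eY₂ eX₂ = true
EAdj ez  eX₁ = true
EAdj eX₁ ez  = true
EAdj ez  eY₁ = true
EAdj eY₁ ez  = true
EAdj _   _   = false

IsE : ℕ → Graph → Set
IsE k G = Σ (Fin (n G) → ELab) λ lab →
    let c : ELab → ℕ
        c L = countV G (λ v → lab v =ᴱ L)
    in (c ez ≡ 1)
     × (1 ≤ c eX₁) × (1 ≤ c eX₂) × (1 ≤ c eY₁) × (1 ≤ c eY₂)
     × (c eY₁ + c eY₂ ≡ k ∸ 1) × (c eX₁ + c eX₂ ≡ k ∸ 1)
     × (c eX₂ + c eY₂ ≤ k ∸ 1)
     × (∀ u v → ¬≡ u v → adj G u v ≡ EAdj (lab u) (lab v))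
  where
  open import Relation.Nullary using (¬_)
  ¬≡ : Fin (n G) → Fin (n G) → Set
  ¬≡ u v = ¬ (u ≡ v)

-- Every vertex has degree at most 2(k − 2); the handshake lemma then gives
-- 2|E| ≤ |V| · 2(k − 2). Adjacency is determined by the labels, so a vertex is
-- adjacent only to vertices of the classes adjacent to its own, and never to
-- itself. For a vertex in a clique class (X, Y₁, Y₂, resp. X₁, X₂, Y₁, Y₂) those
-- classes have total size at most 2(k − 2) + 1, and for x₁, x₂, z they are two
-- classes of size at most k − 2 each. Only class sizes and nonemptiness enter
-- (e.g. |Y₂| ≤ k − 2 because Y₁ ≠ ∅).
module Submission where

open import Defs
open import Data.Nat using (ℕ; _≤_; _*_; _∸_)
open import Data.Sum using (_⊎_)

open import Data.Nat using (suc; _+_; _<ᵇ_; z≤n; s≤s; s≤s⁻¹)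
open import Data.Nat.Properties
open import Data.Nat.Tactic.RingSolver using (solve-∀)
open import Algebra.Properties.CommutativeSemigroup +-commutativeSemigroup
  using (interchange; xy∙z≈xz∙y)
open import Algebra.Properties.CommutativeSemigroup *-commutativeSemigroup
  using () renaming (x∙yz≈y∙xz to *-left-comm)
open import Data.Bool using (Bool; true; false; _∧_; T)
open import Data.Bool.Properties using (T?)
open import Data.Empty using (⊥-elim)
open import Data.List using (List; []; _∷_; _++_; length; filter; map; concatMap; allFin)
open import Data.List.Properties using (length-tabulate)
open import Data.List.Relation.Unary.Any using (here; there)
open import Data.List.Membership.Propositional using (_∈_)
open import Data.List.Membership.Propositional.Properties using (∈-allFin; ∈-filter⁺)
open import Data.Fin using (Fin; toℕ)
import Data.Fin as Fin
open import Data.Product using (_×_; _,_)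
open import Data.Sum using (inj₁; inj₂)
open import Data.Unit using (tt)
open import Function using (id)
open import Relation.Nullary using (¬_; yes; no)
open import Relation.Binary.PropositionalEquality
  using (_≡_; refl; trans; cong; cong₂; subst; module ≡-Reasoning)
  renaming (sym to ≡-sym)

𝟙 : Bool → ℕ
𝟙 true  = 1
𝟙 false = 0

∑ : {A : Set} → List A → (A → ℕ) → ℕ
∑ []       f = 0
∑ (x ∷ xs) f = f x + ∑ xs f

syntax ∑ xs (λ x → e) = ∑[ x ∈ xs ] e

module _ {A : Set} where

  length-filter≡∑𝟙 : (p : A → Bool) (xs : List A) →
                     length (filter (λ x → T? (p x)) xs) ≡ ∑[ x ∈ xs ] 𝟙 (p x)
  length-filter≡∑𝟙 p []       = refl
  length-filter≡∑𝟙 p (x ∷ xs) with p x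
  ... | true  = cong suc (length-filter≡∑𝟙 p xs)
  ... | false = length-filter≡∑𝟙 p xs

  ∑-cong : (xs : List A) {f g : A → ℕ} → (∀ x → f x ≡ g x) → ∑ xs f ≡ ∑ xs g
  ∑-cong []       f≗g = refl
  ∑-cong (x ∷ xs) f≗g = cong₂ _+_ (f≗g x) (∑-cong xs f≗g)

  ∑-mono-≤ : (xs : List A) {f g : A → ℕ} → (∀ x → f x ≤ g x) → ∑ xs f ≤ ∑ xs g
  ∑-mono-≤ []       f≤g = z≤n
  ∑-mono-≤ (x ∷ xs) f≤g = +-mono-≤ (f≤g x) (∑-mono-≤ xs f≤g)

  ∑-mono-≤-with-gap : (xs : List A) {f g : A → ℕ} {u : A} (h : ℕ) → u ∈ xs →
                      (∀ x → f x ≤ g x) → f u + h ≤ g u → ∑ xs f + h ≤ ∑ xs g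
  ∑-mono-≤-with-gap (x ∷ xs) {f} {g} h (here refl) f≤g gap = begin
    f x + ∑ xs f + h   ≡⟨ xy∙z≈xz∙y (f x) _ h ⟩
    f x + h + ∑ xs f   ≤⟨ +-mono-≤ gap (∑-mono-≤ xs f≤g) ⟩
    g x + ∑ xs g       ∎
    where open ≤-Reasoning
  ∑-mono-≤-with-gap (x ∷ xs) {f} {g} h (there u∈xs) f≤g gap = begin
    f x + ∑ xs f + h   ≡⟨ +-assoc (f x) _ h ⟩
    f x + (∑ xs f + h) ≤⟨ +-mono-≤ (f≤g x) (∑-mono-≤-with-gap xs h u∈xs f≤g gap) ⟩
    g x + ∑ xs g       ∎
    where open ≤-Reasoning

  ∑-zero : (xs : List A) → ∑[ _ ∈ xs ] 0 ≡ 0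
  ∑-zero []       = refl
  ∑-zero (x ∷ xs) = ∑-zero xs

  ∈⇒≤∑ : (xs : List A) (f : A → ℕ) {u : A} → u ∈ xs → f u ≤ ∑ xs f
  ∈⇒≤∑ xs f {u} u∈xs = subst (_≤ ∑ xs f) (cong (_+ f u) (∑-zero xs))
    (∑-mono-≤-with-gap xs (f u) u∈xs (λ _ → z≤n) ≤-refl)

  ∑-const : (xs : List A) (c : ℕ) → ∑[ _ ∈ xs ] c ≡ length xs * c
  ∑-const []       c = refl
  ∑-const (x ∷ xs) c = cong (c +_) (∑-const xs c)

  ∑-distrib-+ : (xs : List A) (f g : A → ℕ) →
                ∑[ x ∈ xs ] (f x + g x) ≡ ∑ xs f + ∑ xs g
  ∑-distrib-+ []       f g = refl
  ∑-distrib-+ (x ∷ xs) f g = begin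
    f x + g x + ∑[ y ∈ xs ] (f y + g y) ≡⟨ cong (f x + g x +_) (∑-distrib-+ xs f g) ⟩
    f x + g x + (∑ xs f + ∑ xs g)       ≡⟨ interchange (f x) (g x) _ _ ⟩
    f x + ∑ xs f + (g x + ∑ xs g)       ∎
    where open ≡-Reasoning

  ∑-++ : (xs ys : List A) (f : A → ℕ) → ∑ (xs ++ ys) f ≡ ∑ xs f + ∑ ys f
  ∑-++ []       ys f = refl
  ∑-++ (x ∷ xs) ys f = trans (cong (f x +_) (∑-++ xs ys f)) (≡-sym (+-assoc (f x) _ _))

module _ {A B : Set} where

  ∑-map : (g : A → B) (xs : List A) (f : B → ℕ) → ∑ (map g xs) f ≡ ∑[ x ∈ xs ] f (g x)
  ∑-map g []       f = refl
  ∑-map g (x ∷ xs) f = cong (f (g x) +_) (∑-map g xs f)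

  ∑-concatMap : (h : A → List B) (xs : List A) (f : B → ℕ) →
                ∑ (concatMap h xs) f ≡ ∑[ x ∈ xs ] ∑ (h x) f
  ∑-concatMap h []       f = refl
  ∑-concatMap h (x ∷ xs) f =
    trans (∑-++ (h x) (concatMap h xs) f) (cong (∑ (h x) f +_) (∑-concatMap h xs f))

  ∑-comm : (xs : List A) (ys : List B) (f : A → B → ℕ) →
           ∑[ x ∈ xs ] ∑[ y ∈ ys ] f x y ≡ ∑[ y ∈ ys ] ∑[ x ∈ xs ] f x y
  ∑-comm []       ys f = ≡-sym (∑-zero ys)
  ∑-comm (x ∷ xs) ys f = trans (cong (∑ ys (f x) +_) (∑-comm xs ys f))
                               (≡-sym (∑-distrib-+ ys (f x) (λ y → ∑[ x ∈ xs ] f x y)))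

ordered-pairs≤𝟙 : ∀ i j b → 𝟙 ((i <ᵇ j) ∧ b) + 𝟙 ((j <ᵇ i) ∧ b) ≤ 𝟙 b
ordered-pairs≤𝟙 i j b with i <ᵇ j in i<j | j <ᵇ i in j<i
... | false | false = z≤n
... | false | true  = ≤-refl
... | true  | false = ≤-reflexive (+-identityʳ (𝟙 b))
... | true  | true  = ⊥-elim (<-asym (<ᵇ⇒< i j (subst T (≡-sym i<j) tt))
                                    (<ᵇ⇒< j i (subst T (≡-sym j<i) tt)))

module Handshake (G : Graph) where

  V : List (Fin (n G))
  V = allFin (n G)

  degree : Fin (n G) → ℕ
  degree u = ∑[ v ∈ V ] 𝟙 (adj G u v)

  edge : Fin (n G) → Fin (n G) → ℕ
  edge u v = 𝟙 ((toℕ u <ᵇ toℕ v) ∧ adj G u v)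

  ∣E∣≡∑edge : ∣E∣ G ≡ ∑[ u ∈ V ] ∑[ v ∈ V ] edge u v
  ∣E∣≡∑edge = begin
    ∣E∣ G                                  ≡⟨ length-filter≡∑𝟙 isEdge pairs ⟩
    ∑[ p ∈ pairs ] 𝟙 (isEdge p)            ≡⟨ ∑-concatMap row V (λ p → 𝟙 (isEdge p)) ⟩
    ∑[ u ∈ V ] ∑[ p ∈ row u ] 𝟙 (isEdge p) ≡⟨ ∑-cong V (λ u → ∑-map (u ,_) V (λ p → 𝟙 (isEdge p))) ⟩
    ∑[ u ∈ V ] ∑[ v ∈ V ] edge u v         ∎
    where
    open ≡-Reasoning
    isEdge : Fin (n G) × Fin (n G) → Bool
    isEdge (u , v) = (toℕ u <ᵇ toℕ v) ∧ adj G u v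
    row : Fin (n G) → List (Fin (n G) × Fin (n G))
    row u = map (u ,_) V
    pairs : List (Fin (n G) × Fin (n G))
    pairs = concatMap row V

  2∣E∣≤∑degree : 2 * ∣E∣ G ≤ ∑ V degree
  2∣E∣≤∑degree = begin
    2 * ∣E∣ G                                          ≡⟨ cong (∣E∣ G +_) (+-identityʳ _) ⟩
    ∣E∣ G + ∣E∣ G                                      ≡⟨ cong₂ _+_ ∣E∣≡∑edge (trans ∣E∣≡∑edge (∑-comm V V edge)) ⟩
    ∑ V (λ u → ∑ V (edge u)) + ∑ V (λ u → ∑ V (λ v → edge v u))
                                                       ≡⟨ ∑-distrib-+ V _ _ ⟨
    ∑ V (λ u → ∑ V (edge u) + ∑ V (λ v → edge v u))    ≡⟨ ∑-cong V (λ u → ∑-distrib-+ V _ _) ⟨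
    ∑[ u ∈ V ] ∑[ v ∈ V ] (edge u v + edge v u)        ≤⟨ ∑-mono-≤ V (λ u → ∑-mono-≤ V (both-orders u)) ⟩
    ∑ V degree                                         ∎
    where
    open ≤-Reasoning
    both-orders : ∀ u v → edge u v + edge v u ≤ 𝟙 (adj G u v)
    both-orders u v rewrite sym G v u = ordered-pairs≤𝟙 (toℕ u) (toℕ v) (adj G u v)

  ∣E∣≤∣V∣*d : (d : ℕ) → (∀ u → degree u ≤ 2 * d) → ∣E∣ G ≤ ∣V∣ G * d
  ∣E∣≤∣V∣*d d degree≤2d = *-cancelˡ-≤ 2 (begin
    2 * ∣E∣ G           ≤⟨ 2∣E∣≤∑degree ⟩
    ∑ V degree          ≤⟨ ∑-mono-≤ V degree≤2d ⟩
    ∑[ _ ∈ V ] (2 * d)  ≡⟨ ∑-const V (2 * d) ⟩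
    length V * (2 * d)  ≡⟨ cong (_* (2 * d)) (length-tabulate {n = n G} id) ⟩
    n G * (2 * d)       ≡⟨ *-left-comm (n G) 2 d ⟩
    2 * (n G * d)       ∎)
    where open ≤-Reasoning

adjacentLabels : {L : Set} → (L → L → Bool) → List L → L → List L
adjacentLabels Adj labels ℓ = filter (λ M → T? (Adj ℓ M)) labels

module LabelledGraph
  (G : Graph) {L : Set} (_≟ᴸ_ : L → L → Bool) (≟ᴸ-refl : ∀ ℓ → (ℓ ≟ᴸ ℓ) ≡ true)
  (labels : List L) (∈labels : ∀ ℓ → ℓ ∈ labels)
  (Adj : L → L → Bool) (lab : Fin (n G) → L)
  (adj≡Adj : ∀ u v → ¬ (u ≡ v) → adj G u v ≡ Adj (lab u) (lab v)) where

  open Handshake G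

  classSize : L → ℕ
  classSize M = countV G (λ v → lab v ≟ᴸ M)

  𝟙Adj≤∑𝟙≟ : ∀ ℓ m → 𝟙 (Adj ℓ m) ≤ ∑[ M ∈ adjacentLabels Adj labels ℓ ] 𝟙 (m ≟ᴸ M)
  𝟙Adj≤∑𝟙≟ ℓ m with Adj ℓ m in ℓ~m
  ... | false = z≤n
  ... | true  = subst (_≤ ∑ N (λ M → 𝟙 (m ≟ᴸ M))) (cong 𝟙 (≟ᴸ-refl m))
    (∈⇒≤∑ N (λ M → 𝟙 (m ≟ᴸ M)) (∈-filter⁺ (λ M → T? (Adj ℓ M)) (∈labels m)
                                            (subst T (≡-sym ℓ~m) tt)))
    where N = adjacentLabels Adj labels ℓ

  degree+𝟙≤∑classSize : ∀ u → degree u + 𝟙 (Adj (lab u) (lab u))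
                              ≤ ∑ (adjacentLabels Adj labels (lab u)) classSize
  degree+𝟙≤∑classSize u = begin
    degree u + 𝟙 (Adj ℓ ℓ)                   ≤⟨ ∑-mono-≤-with-gap V _ (∈-allFin u) adj≤Adj self ⟩
    ∑[ v ∈ V ] 𝟙 (Adj ℓ (lab v))             ≤⟨ ∑-mono-≤ V (λ v → 𝟙Adj≤∑𝟙≟ ℓ (lab v)) ⟩
    ∑[ v ∈ V ] ∑[ M ∈ N ] 𝟙 (lab v ≟ᴸ M)     ≡⟨ ∑-comm V N _ ⟩
    ∑[ M ∈ N ] ∑[ v ∈ V ] 𝟙 (lab v ≟ᴸ M)     ≡⟨ ∑-cong N (λ M → length-filter≡∑𝟙 (λ v → lab v ≟ᴸ M) V) ⟨
    ∑ N classSize                            ∎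
    where
    open ≤-Reasoning
    ℓ = lab u
    N = adjacentLabels Adj labels ℓ
    adj≤Adj : ∀ v → 𝟙 (adj G u v) ≤ 𝟙 (Adj ℓ (lab v))
    adj≤Adj v with u Fin.≟ v
    ... | yes refl rewrite irrefl G u = z≤n
    ... | no u≢v   = ≤-reflexive (cong 𝟙 (adj≡Adj u v u≢v))
    self : 𝟙 (adj G u u) + 𝟙 (Adj ℓ ℓ) ≤ 𝟙 (Adj ℓ ℓ)
    self rewrite irrefl G u = ≤-refl

summand≤ : ∀ {a b s} → a + b ≡ suc s → 1 ≤ b → a ≤ s
summand≤ {a} {b} {s} a+b≡1+s 1≤b =
  s≤s⁻¹ (subst (_≤ suc s) (+-comm a 1) (≤-trans (+-monoʳ-≤ a 1≤b) (≤-reflexive a+b≡1+s)))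

summand≤′ : ∀ {a b s} → a + b ≡ suc s → 1 ≤ a → b ≤ s
summand≤′ {a} {b} a+b≡1+s = summand≤ (trans (+-comm b a) a+b≡1+s)

-- The trailing `+ 0`s below are the tails of ∑ over concrete lists of labels.

clique-degree≤ : ∀ a b {d e s} → d + 1 ≤ a + (b + e) → a + b ≡ suc s → d ≤ s + e
clique-degree≤ a b {d} {e} {s} d+1≤ a+b≡1+s = s≤s⁻¹ (subst (_≤ suc (s + e)) (+-comm d 1) (begin
  d + 1         ≤⟨ d+1≤ ⟩
  a + (b + e)   ≡⟨ +-assoc a b e ⟨
  a + b + e     ≡⟨ cong (_+ e) a+b≡1+s ⟩
  suc (s + e)   ∎))
  where open ≤-Reasoning

+-rotate : ∀ x y z → x + (y + (z + 0)) ≡ y + (z + (x + 0))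
+-rotate = solve-∀

m+n≤2*m : ∀ {m n} → n ≤ m → m + (n + 0) ≤ 2 * m
m+n≤2*m {m} n≤m = +-monoʳ-≤ m (+-monoˡ-≤ 0 n≤m)

two-classes-degree≤2* : ∀ {d a b s} → d + 0 ≤ a + (b + 0) → a ≤ s → b ≤ s → d ≤ 2 * s
two-classes-degree≤2* {d} d≤a+b a≤s b≤s =
  ≤-trans (m≤m+n d 0) (≤-trans d≤a+b (+-mono-≤ a≤s (+-monoˡ-≤ 0 b≤s)))

allDLabs : List DLab
allDLabs = dX ∷ dY₁ ∷ dY₂ ∷ dx₁ ∷ dx₂ ∷ []

∈allDLabs : ∀ ℓ → ℓ ∈ allDLabs
∈allDLabs dX  = here refl
∈allDLabs dY₁ = there (here refl)
∈allDLabs dY₂ = there (there (here refl))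
∈allDLabs dx₁ = there (there (there (here refl)))
∈allDLabs dx₂ = there (there (there (there (here refl))))

=ᴰ-refl : ∀ ℓ → (ℓ =ᴰ ℓ) ≡ true
=ᴰ-refl dX  = refl
=ᴰ-refl dY₁ = refl
=ᴰ-refl dY₂ = refl
=ᴰ-refl dx₁ = refl
=ᴰ-refl dx₂ = refl

D-degree≤2* : ∀ {s} (c : DLab → ℕ) → 1 ≤ s → c dx₁ ≡ 1 → c dx₂ ≡ 1 → 1 ≤ c dY₁ → 1 ≤ c dY₂ →
              c dY₁ + c dY₂ ≡ suc s → c dX + 1 ≡ suc s →
              ∀ ℓ {d} → d + 𝟙 (DAdj ℓ ℓ) ≤ ∑ (adjacentLabels DAdj allDLabs ℓ) c → d ≤ 2 * s
D-degree≤2* c 1≤s x₁ x₂ _  _  ∣Y∣ ∣X∣ dX  h rewrite x₁ | x₂ =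
  ≤-trans (clique-degree≤ (c dX) 1 h ∣X∣) (m+n≤2*m 1≤s)
D-degree≤2* c 1≤s x₁ _  _  _  ∣Y∣ _   dY₁ h rewrite x₁ =
  ≤-trans (clique-degree≤ (c dY₁) (c dY₂) h ∣Y∣) (m+n≤2*m 1≤s)
D-degree≤2* c 1≤s _  x₂ _  _  ∣Y∣ _   dY₂ h rewrite x₂ =
  ≤-trans (clique-degree≤ (c dY₁) (c dY₂) h ∣Y∣) (m+n≤2*m 1≤s)
D-degree≤2* c _   _  _  _  Y₂ ∣Y∣ ∣X∣ dx₁ h = two-classes-degree≤2* h (summand≤ ∣X∣ ≤-refl) (summand≤ ∣Y∣ Y₂)
D-degree≤2* c _   _  _  Y₁ _  ∣Y∣ ∣X∣ dx₂ h = two-classes-degree≤2* h (summand≤ ∣X∣ ≤-refl) (summand≤′ ∣Y∣ Y₁)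

allELabs : List ELab
allELabs = eX₁ ∷ eX₂ ∷ eY₁ ∷ eY₂ ∷ ez ∷ []

∈allELabs : ∀ ℓ → ℓ ∈ allELabs
∈allELabs eX₁ = here refl
∈allELabs eX₂ = there (here refl)
∈allELabs eY₁ = there (there (here refl))
∈allELabs eY₂ = there (there (there (here refl)))
∈allELabs ez  = there (there (there (there (here refl))))

=ᴱ-refl : ∀ ℓ → (ℓ =ᴱ ℓ) ≡ true
=ᴱ-refl eX₁ = refl
=ᴱ-refl eX₂ = refl
=ᴱ-refl eY₁ = refl
=ᴱ-refl eY₂ = refl
=ᴱ-refl ez  = refl

E-degree≤2* : ∀ {s} (c : ELab → ℕ) → 1 ≤ s → c ez ≡ 1 →
              1 ≤ c eX₁ → 1 ≤ c eX₂ → 1 ≤ c eY₁ → 1 ≤ c eY₂ →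
              c eY₁ + c eY₂ ≡ suc s → c eX₁ + c eX₂ ≡ suc s →
              ∀ ℓ {d} → d + 𝟙 (EAdj ℓ ℓ) ≤ ∑ (adjacentLabels EAdj allELabs ℓ) c → d ≤ 2 * s
E-degree≤2* c 1≤s z _  _  _  _  _   ∣X∣ eX₁ h rewrite z =
  ≤-trans (clique-degree≤ (c eX₁) (c eX₂) h ∣X∣) (m+n≤2*m 1≤s)
E-degree≤2* c 1≤s z _  _  _  _  ∣Y∣ _   eY₁ h rewrite z =
  ≤-trans (clique-degree≤ (c eY₁) (c eY₂) h ∣Y∣) (m+n≤2*m 1≤s)
E-degree≤2* c _   _ _  _  Y₁ _  ∣Y∣ ∣X∣ eX₂ h =
  ≤-trans (clique-degree≤ (c eX₁) (c eX₂) h ∣X∣) (m+n≤2*m (summand≤′ ∣Y∣ Y₁))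
E-degree≤2* c _   _ X₁ _  _  _  ∣Y∣ ∣X∣ eY₂ h =
  -- the classes adjacent to Y₂ come out of ∑ in the order X₂, Y₁, Y₂
  ≤-trans (clique-degree≤ (c eY₁) (c eY₂) (≤-trans h (≤-reflexive (+-rotate (c eX₂) (c eY₁) (c eY₂)))) ∣Y∣)
          (m+n≤2*m (summand≤′ ∣X∣ X₁))
E-degree≤2* c _   _ _  X₂ _  Y₂ ∣Y∣ ∣X∣ ez  h = two-classes-degree≤2* h (summand≤ ∣X∣ X₂) (summand≤ ∣Y∣ Y₂)

proposition3p4 : (k : ℕ) → 3 ≤ k → (G : Graph) → IsD k G ⊎ IsE k G →
    ∣E∣ G ≤ ∣V∣ G * (k ∸ 2)
proposition3p4 (suc (suc s)) (s≤s (s≤s 1≤s)) G (inj₁ (lab , x₁ , x₂ , _ , Y₁ , Y₂ , ∣Y∣ , ∣X∣ , adj≡)) =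
  Handshake.∣E∣≤∣V∣*d G s λ u →
    D-degree≤2* classSize 1≤s x₁ x₂ Y₁ Y₂ ∣Y∣ ∣X∣ (lab u) (degree+𝟙≤∑classSize u)
  where open LabelledGraph G _=ᴰ_ =ᴰ-refl allDLabs ∈allDLabs DAdj lab adj≡
proposition3p4 (suc (suc s)) (s≤s (s≤s 1≤s)) G (inj₂ (lab , z , X₁ , X₂ , Y₁ , Y₂ , ∣Y∣ , ∣X∣ , _ , adj≡)) =
  Handshake.∣E∣≤∣V∣*d G s λ u →
    E-degree≤2* classSize 1≤s z X₁ X₂ Y₁ Y₂ ∣Y∣ ∣X∣ (lab u) (degree+𝟙≤∑classSize u)
  where open LabelledGraph G _=ᴱ_ =ᴱ-refl allELabs ∈allELabs EAdj lab adj≡
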